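{- For each $n$, let $R_n\subset\{1,\ldots,n\}^2$ be a set of cells of the $n\times n$ grid which is southeast-justified (if $(i,j)\in R_n$ then $(i',j')\in R_n$ for all $i'\ge i$, $j'\ge j$, with $i',j'\le n$) and does not touch the north or west boundary of the grid. Suppose that there is a constant $c>0$, independent of $n$, such that for a uniformly random reduced bumpless pipe dream of size $n$, every tile $(i,j)\in R_n$ is a cross with probability at least $1-e^{ -cn}$. Let $w$ be the boundary permutation of a uniformly random reduced bumpless pipe dream of size $n$. Then there exists a constant $c'>0$ such that, for all sufficiently large $n$, with probability at least $1-e^{ -c'n}$ we have $(w(k),k)\notin R_n$ for all $k\in\{1,\ldots,n\}$.
   Context: Cells are indexed $(i,j)$ with row $i$ from top ($1$) to bottom ($n$) and column $j$ from left to right, so $(1,1)$ is the northwest corner. A bumpless pipe dream (BPD) of size $n$ is a tiling of the $n\times n$ grid by the tiles empty, cross, horizontal (west–east segment), vertical (south–north), r-elbow (joining south and east edge midpoints), j-elbow (joining north and west), such that segments match across adjacent cells, no segment touches the north or west boundary, and every edge on the south and east boundary carries a segment. This yields $n$ pipes: pipe $k$ enters from the south boundary at column $k$ and travels only north and east, exiting through the east boundary at some row, denoted $w(k)$; $w$ is the boundary permutation. At a cross tile, the pipe traveling vertically continues north. A BPD is reduced if each pair of pipes crosses at most once. (The law of $w$ is $\mathbb{P}(w)\propto\mathfrak{S}_w(1^n)$, the Schubert measure.) -}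

module Defs where

open import Data.Nat using (ℕ; zero; suc; _+_; _*_; _∸_; _^_; _≤_; _<_; _≡ᵇ_; _<ᵇ_; _≤ᵇ_; _<?_)
open import Data.Fin using (Fin; toℕ; fromℕ<)
open import Data.Bool using (Bool; true; false; _∧_; _∨_; not; _xor_; if_then_else_)
open import Data.List using (List; []; _∷_; [_]; map; concatMap; allFin)
open import Data.Bool.ListAction using (all; any)
open import Data.Maybe using (Maybe; just; nothing)
open import Data.Product using (_×_; _,_; proj₁; proj₂)
open import Data.Vec.Functional using () renaming (_∷_ to _∷ᶠ_)
open import Relation.Nullary using (yes; no)
open import Relation.Binary.PropositionalEquality using (_≡_)

data Tile : Set where
  empty cross horiz vert relb jelb : Tile

north south east west : Tile → Bool
north cross = true
north vert  = true
north jelb  = true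
north _     = false
south cross = true
south vert  = true
south relb  = true
south _     = false
east cross = true
east horiz = true
east relb  = true
east _     = false
west cross = true
west horiz = true
west jelb  = true
west _     = false

isCross : Tile → Bool
isCross cross = true
isCross _     = false

allTiles : List Tile
allTiles = empty ∷ cross ∷ horiz ∷ vert ∷ relb ∷ jelb ∷ []

-- A tiling of the n×n grid; (g i j) is the tile in row i (0 = top / north)
-- and column j (0 = left / west).  Cell (i,j) here is cell (i+1,j+1) of the paper.
Grid : ℕ → Set
Grid n = Fin n → Fin n → Tile

tileAt : ∀ {n} → Grid n → ℕ → ℕ → Maybe Tile
tileAt {n} g i j with i <? n | j <? n
... | yes p | yes q = just (g (fromℕ< p) (fromℕ< q))
... | _     | _     = nothing

eqB : Bool → Bool → Bool
eqB x y = not (x xor y)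

cellOK : ∀ {n} → Grid n → ℕ → ℕ → Tile → Bool
cellOK g i j t =
  (if i ≡ᵇ 0 then not (north t) else true) ∧
  (if j ≡ᵇ 0 then not (west t) else true) ∧
  eastOK (tileAt g i (suc j)) ∧
  southOK (tileAt g (suc i) j)
  where
  eastOK : Maybe Tile → Bool
  eastOK nothing   = east t
  eastOK (just t') = eqB (east t) (west t')
  southOK : Maybe Tile → Bool
  southOK nothing   = south t
  southOK (just t') = eqB (south t) (north t')

isBPD : ∀ {n} → Grid n → Bool
isBPD {n} g = all (λ i → all (λ j → cellOK g (toℕ i) (toℕ j) (g i j)) (allFin n)) (allFin n)

data Dir : Set where
  fromS fromW : Dir

data Out : Set where
  goN goE : Out

exitDir : Dir → Tile → Maybe Out
exitDir fromS vert  = just goN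
exitDir fromS cross = just goN
exitDir fromS relb  = just goE
exitDir fromW horiz = just goE
exitDir fromW cross = just goE
exitDir fromW jelb  = just goN
exitDir _     _     = nothing

Cell : Set
Cell = ℕ × ℕ

-- walk with fuel: returns the list of visited cells and (if the pipe exits
-- through the east boundary) the 0-indexed row where it exits.
walk : ∀ {n} → Grid n → ℕ → ℕ → ℕ → Dir → List Cell × Maybe ℕ
walk g zero i j d = [] , nothing
walk {n} g (suc f) i j d = atTile (tileAt g i j)
  where
  cons : List Cell × Maybe ℕ → List Cell × Maybe ℕ
  cons (cs , r) = ((i , j) ∷ cs) , r
  goNorth : ℕ → List Cell × Maybe ℕ
  goNorth zero     = [ (i , j) ] , nothing
  goNorth (suc i') = cons (walk g f i' j fromS)
  move : Maybe Out → List Cell × Maybe ℕ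
  move nothing    = [ (i , j) ] , nothing
  move (just goN) = goNorth i
  move (just goE) = if suc j ≡ᵇ n then ([ (i , j) ] , just i)
                    else cons (walk g f i (suc j) fromW)
  atTile : Maybe Tile → List Cell × Maybe ℕ
  atTile nothing  = [] , nothing
  atTile (just t) = move (exitDir d t)

pipe : ∀ {n} → Grid n → Fin n → List Cell × Maybe ℕ
pipe {n} g k = walk g (n + n) (n ∸ 1) (toℕ k) fromS

boundaryPerm : ∀ {n} → Grid n → Fin n → Maybe ℕ
boundaryPerm g k = proj₂ (pipe g k)

eqCell : Cell → Cell → Bool
eqCell (a , b) (c , d) = (a ≡ᵇ c) ∧ (b ≡ᵇ d)

lengthB : ∀ {A : Set} → (A → Bool) → List A → ℕ
lengthB p [] = 0
lengthB p (x ∷ xs) = if p x then suc (lengthB p xs) else lengthB p xs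

crossAt : ∀ {n} → Grid n → Cell → Bool
crossAt g (i , j) with tileAt g i j
... | just t  = isCross t
... | nothing = false

crossings : ∀ {n} → Grid n → Fin n → Fin n → ℕ
crossings g a b =
  lengthB (λ c → crossAt g c ∧ any (eqCell c) (proj₁ (pipe g b))) (proj₁ (pipe g a))

isReduced : ∀ {n} → Grid n → Bool
isReduced {n} g =
  all (λ a → all (λ b → not (toℕ a <ᵇ toℕ b) ∨ (crossings g a b ≤ᵇ 1)) (allFin n)) (allFin n)

isRBPD : ∀ {n} → Grid n → Bool
isRBPD g = isBPD g ∧ isReduced g

allFuns : ∀ {A : Set} (n : ℕ) → List A → List (Fin n → A)
allFuns zero    xs = [ (λ ()) ]
allFuns (suc n) xs = concatMap (λ x → map (λ f → x ∷ᶠ f) (allFuns n xs)) xs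

allGrids : (n : ℕ) → List (Grid n)
allGrids n = allFuns n (allFuns n allTiles)

numRBPD : ℕ → ℕ
numRBPD n = lengthB isRBPD (allGrids n)

countRBPD : (n : ℕ) → (Grid n → Bool) → ℕ
countRBPD n E = lengthB (λ g → isRBPD g ∧ E g) (allGrids n)

Region : ℕ → Set
Region n = Fin n → Fin n → Bool

SEJustified : ∀ {n} → Region n → Set
SEJustified {n} R = ∀ (i j i' j' : Fin n) → R i j ≡ true →
  toℕ i ≤ toℕ i' → toℕ j ≤ toℕ j' → R i' j' ≡ true

AvoidsNW : ∀ {n} → Region n → Set
AvoidsNW {n} R = ∀ (i j : Fin n) → R i j ≡ true → (0 < toℕ i) × (0 < toℕ j)

regionAt : ∀ {n} → Region n → ℕ → Fin n → Bool
regionAt {n} R r k with r <? n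
... | yes p = R (fromℕ< p) k
... | no _  = false

hitsRegion : ∀ {n} → Region n → Grid n → Bool
hitsRegion {n} R g = any (λ k → hit (boundaryPerm g k) k) (allFin n)
  where
  hit : Maybe ℕ → Fin n → Bool
  hit nothing  k = false
  hit (just r) k = regionAt R r k

-- A pipe exiting east at row w(k) travels north in column k up to the r-elbow
-- where it turns east; after that it never moves south, so the elbow lies at or
-- below row w(k).  If (w(k), k) ∈ R, southeast-justification puts the elbow in R,
-- and an r-elbow is not a cross.  Hence the event is covered by the n² events
-- "cell (i,j) ∈ R is not a cross", so its probability is at most n² (a/b)ⁿ.
-- By Bernoulli's inequality n² (2a)ⁿ ≤ (2a+1)ⁿ once n ≥ 4(2a)², so
-- a′/b′ = (2a+1)/(2b) works.

module Submission where

open import Defs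
open import Data.Nat using (ℕ; NonZero; zero; suc; _+_; _*_; _^_; _≤_; _<_; _≤′_; ≤′-refl; ≤′-step; z≤n; s≤s; _≡ᵇ_; _<?_)
open import Data.Nat.Properties
open import Algebra.Properties.CommutativeSemigroup *-commutativeSemigroup using (interchange; x∙yz≈y∙xz; x∙yz≈xz∙y)
open import Data.Nat.Tactic.RingSolver using (solve; solve-∀)
open import Data.Fin using (Fin; toℕ; fromℕ<)
open import Data.Fin.Properties using (toℕ-fromℕ<; fromℕ<-toℕ)
open import Data.Bool using (Bool; true; false; not; _∧_; _∨_)
open import Data.Bool.Properties using (∧-zeroʳ; ∧-distribˡ-∨; ∨-zeroʳ)
open import Data.Bool.ListAction using (any)
open import Data.List using ([]; _∷_; length; allFin)
open import Data.List.Properties using (length-tabulate)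
open import Data.List.Membership.Propositional using (_∈_)
open import Data.List.Membership.Propositional.Properties using (∈-allFin)
open import Data.List.Relation.Unary.Any using (here; there)
open import Data.Maybe using (just; nothing)
open import Data.Maybe.Properties using (just-injective)
open import Data.Product using (Σ; _×_; _,_; proj₂)
open import Relation.Nullary using (yes; no)
open import Relation.Binary.PropositionalEquality using (_≡_; refl; sym; trans; cong; subst)
open import Function using (case_of_; id)

walk-exitRow≤ : ∀ {n} (g : Grid n) f i j d {r} → proj₂ (walk g f i j d) ≡ just r → r ≤ i
walk-exitRow≤ g zero i j d ()
walk-exitRow≤ {n} g (suc f) i j d eq with tileAt g i j
walk-exitRow≤ g (suc f) i j d () | nothing
... | just t with exitDir d t
walk-exitRow≤ g (suc f) i j d () | just t | nothing
walk-exitRow≤ g (suc f) zero j d () | just t | just goN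
walk-exitRow≤ g (suc f) (suc i) j d eq | just t | just goN = m≤n⇒m≤1+n (walk-exitRow≤ g f i j fromS eq)
... | just goE with suc j ≡ᵇ n
...   | true  = ≤-reflexive (sym (just-injective eq))
...   | false = walk-exitRow≤ g f i (suc j) fromW eq

relb-at-fromℕ< : ∀ {n} (g : Grid n) {i r} (j : Fin n) (i<n : i < n) (j<n : toℕ j < n) →
  g (fromℕ< i<n) (fromℕ< j<n) ≡ relb → r ≤ i → Σ (Fin n) λ i₀ → r ≤ toℕ i₀ × g i₀ j ≡ relb
relb-at-fromℕ< g {r = r} j i<n j<n tile r≤i =
  fromℕ< i<n ,
  subst (r ≤_) (sym (toℕ-fromℕ< i<n)) r≤i ,
  subst (λ j′ → g (fromℕ< i<n) j′ ≡ relb) (fromℕ<-toℕ j j<n) tile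

walk-north-turnsAt-relb : ∀ {n} (g : Grid n) f i (j : Fin n) {r} →
  proj₂ (walk g f i (toℕ j) fromS) ≡ just r → Σ (Fin n) λ i₀ → r ≤ toℕ i₀ × g i₀ j ≡ relb
walk-north-turnsAt-relb g zero i j ()
walk-north-turnsAt-relb {n} g (suc f) i j eq with i <? n | toℕ j <? n
walk-north-turnsAt-relb g (suc f) i j () | no _  | _
walk-north-turnsAt-relb g (suc f) i j () | yes _ | no _
... | yes i<n | yes j<n with g (fromℕ< i<n) (fromℕ< j<n) in tile
...   | relb with suc (toℕ j) ≡ᵇ n
...     | true  = relb-at-fromℕ< g j i<n j<n tile (≤-reflexive (sym (just-injective eq)))
...     | false = relb-at-fromℕ< g j i<n j<n tile (walk-exitRow≤ g f i (suc (toℕ j)) fromW eq)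
walk-north-turnsAt-relb g (suc f) i j eq | yes _ | yes _ | vert with i
walk-north-turnsAt-relb g (suc f) i j () | yes _ | yes _ | vert | zero
...     | suc i′ = walk-north-turnsAt-relb g f i′ j eq
walk-north-turnsAt-relb g (suc f) i j eq | yes _ | yes _ | cross with i
walk-north-turnsAt-relb g (suc f) i j () | yes _ | yes _ | cross | zero
...     | suc i′ = walk-north-turnsAt-relb g f i′ j eq
walk-north-turnsAt-relb g (suc f) i j () | yes _ | yes _ | empty
walk-north-turnsAt-relb g (suc f) i j () | yes _ | yes _ | horiz
walk-north-turnsAt-relb g (suc f) i j () | yes _ | yes _ | jelb

any-witness : ∀ {A : Set} (p : A → Bool) xs → any p xs ≡ true → Σ A λ x → p x ≡ true
any-witness p (x ∷ xs) e with p x in px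
... | true  = x , px
... | false = any-witness p xs e

any-∈ : ∀ {A : Set} (p : A → Bool) {x xs} → x ∈ xs → p x ≡ true → any p xs ≡ true
any-∈ p {xs = y ∷ _}  (here refl) px rewrite px = refl
any-∈ p {xs = y ∷ ys} (there x∈ys) px rewrite any-∈ p x∈ys px = ∨-zeroʳ (p y)

hitsRegion⇒relb-in-region : ∀ {n} {R : Region n} → SEJustified R → (g : Grid n) →
  hitsRegion R g ≡ true → Σ (Fin n) λ i → Σ (Fin n) λ j → R i j ≡ true × g i j ≡ relb
hitsRegion⇒relb-in-region {n} {R} se g hits with any-witness _ (allFin n) hits
... | k , hit with boundaryPerm g k in w[k]
... | just r with r <? n
...   | yes r<n with walk-north-turnsAt-relb g (n + n) _ k w[k]
...     | i₀ , r≤i₀ , elbow =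
  i₀ , k , se (fromℕ< r<n) k i₀ k hit (subst (_≤ toℕ i₀) (sym (toℕ-fromℕ< r<n)) r≤i₀) ≤-refl , elbow

crossFreeCellIn : ∀ {n} → Region n → Grid n → Bool
crossFreeCellIn {n} R g = any (λ i → any (λ j → R i j ∧ not (isCross (g i j))) (allFin n)) (allFin n)

hitsRegion⇒crossFreeCellIn : ∀ {n} {R : Region n} → SEJustified R → (g : Grid n) →
  hitsRegion R g ≡ true → crossFreeCellIn R g ≡ true
hitsRegion⇒crossFreeCellIn {n} {R} se g hits with hitsRegion⇒relb-in-region se g hits
... | i , j , i,j∈R , elbow =
  any-∈ _ (∈-allFin i) (any-∈ _ (∈-allFin j) notCross)
  where
  notCross : R i j ∧ not (isCross (g i j)) ≡ true
  notCross rewrite i,j∈R | elbow = refl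

lengthB-mono : ∀ {A : Set} {p q : A → Bool} → (∀ x → p x ≡ true → q x ≡ true) →
  ∀ xs → lengthB p xs ≤ lengthB q xs
lengthB-mono p⇒q [] = z≤n
lengthB-mono {p = p} {q} p⇒q (x ∷ xs) with p x in px | q x in qx
... | true  | true  = s≤s (lengthB-mono p⇒q xs)
... | true  | false = case trans (sym qx) (p⇒q x px) of λ ()
... | false | true  = m≤n⇒m≤1+n (lengthB-mono p⇒q xs)
... | false | false = lengthB-mono p⇒q xs

lengthB-∨ : ∀ {A : Set} (p q : A → Bool) xs →
  lengthB (λ x → p x ∨ q x) xs ≤ lengthB p xs + lengthB q xs
lengthB-∨ p q [] = z≤n
lengthB-∨ p q (x ∷ xs) with p x | q x
... | true  | true  = s≤s (≤-trans (lengthB-∨ p q xs) (+-monoʳ-≤ _ (n≤1+n _)))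
... | true  | false = s≤s (lengthB-∨ p q xs)
... | false | true  = ≤-trans (s≤s (lengthB-∨ p q xs)) (≤-reflexive (sym (+-suc _ _)))
... | false | false = lengthB-∨ p q xs

lengthB-∧-false : ∀ {A : Set} (p : A → Bool) xs → lengthB (λ x → p x ∧ false) xs ≡ 0
lengthB-∧-false p [] = refl
lengthB-∧-false p (x ∷ xs) rewrite ∧-zeroʳ (p x) = lengthB-∧-false p xs

-- The union bound, with every count scaled by B.
lengthB-∧-any : ∀ {A I : Set} (p : A → Bool) (q : I → A → Bool) xs is {B D} →
  (∀ i → lengthB (λ x → p x ∧ q i x) xs * B ≤ D) →
  lengthB (λ x → p x ∧ any (λ i → q i x) is) xs * B ≤ length is * D
lengthB-∧-any p q xs [] {B} _ rewrite lengthB-∧-false p xs = z≤n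
lengthB-∧-any p q xs (i ∷ is) {B} {D} bound = begin
  lengthB (λ x → p x ∧ (q i x ∨ anyRest x)) xs * B
    ≤⟨ *-monoˡ-≤ B (lengthB-mono (λ x → trans (sym (∧-distribˡ-∨ (p x) _ _))) xs) ⟩
  lengthB (λ x → (p x ∧ q i x) ∨ (p x ∧ anyRest x)) xs * B
    ≤⟨ *-monoˡ-≤ B (lengthB-∨ _ _ xs) ⟩
  (lengthB (λ x → p x ∧ q i x) xs + lengthB (λ x → p x ∧ anyRest x) xs) * B
    ≡⟨ *-distribʳ-+ B (lengthB (λ x → p x ∧ q i x) xs) (lengthB (λ x → p x ∧ anyRest x) xs) ⟩
  lengthB (λ x → p x ∧ q i x) xs * B + lengthB (λ x → p x ∧ anyRest x) xs * B
    ≤⟨ +-mono-≤ (bound i) (lengthB-∧-any p q xs is bound) ⟩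
  D + length is * D ∎
  where
  open ≤-Reasoning
  anyRest = λ x → any (λ i → q i x) is

∧-monoʳ : ∀ {a b c : Bool} → (b ≡ true → c ≡ true) → a ∧ b ≡ true → a ∧ c ≡ true
∧-monoʳ {true} b⇒c = b⇒c

countRBPD-hitsRegion≤ : ∀ {n} (R : Region n) → SEJustified R → ∀ {B D} →
  (∀ i j → R i j ≡ true → countRBPD n (λ g → not (isCross (g i j))) * B ≤ D) →
  countRBPD n (hitsRegion R) * B ≤ n * (n * D)
countRBPD-hitsRegion≤ {n} R se {B} {D} bound = begin
  countRBPD n (hitsRegion R) * B
    ≤⟨ *-monoˡ-≤ B (lengthB-mono (λ g → ∧-monoʳ (hitsRegion⇒crossFreeCellIn se g)) (allGrids n)) ⟩
  lengthB (λ g → isRBPD g ∧ crossFreeCellIn R g) (allGrids n) * B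
    ≤⟨ lengthB-∧-any isRBPD _ (allGrids n) (allFin n) (λ i →
         lengthB-∧-any isRBPD _ (allGrids n) (allFin n) (cell i)) ⟩
  length (allFin n) * (length (allFin n) * D)
    ≡⟨ cong (λ m → m * (m * D)) (length-tabulate {n = n} id) ⟩
  n * (n * D) ∎
  where
  open ≤-Reasoning
  cell : ∀ i j → lengthB (λ g → isRBPD g ∧ (R i j ∧ not (isCross (g i j)))) (allGrids n) * B ≤ D
  cell i j with R i j in i,j∈R
  ... | true  = bound i j i,j∈R
  ... | false rewrite lengthB-∧-false isRBPD (allGrids n) = z≤n

^-distribʳ-* : ∀ m n o → (m * n) ^ o ≡ m ^ o * n ^ o
^-distribʳ-* m n zero    = refl
^-distribʳ-* m n (suc o) rewrite ^-distribʳ-* m n o = interchange m n (m ^ o) (n ^ o)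

-- Bernoulli's inequality (1 + 1/p)^m ≥ 1 + m/p, cleared of denominators.
[p+m]*p^m≤p*[1+p]^m : ∀ p m → (p + m) * p ^ m ≤ p * suc p ^ m
[p+m]*p^m≤p*[1+p]^m p zero rewrite +-identityʳ p = ≤-refl
[p+m]*p^m≤p*[1+p]^m p (suc m) = begin
  (p + suc m) * (p * p ^ m)             ≤⟨ m≤m+n _ (m * p ^ m) ⟩
  (p + suc m) * (p * p ^ m) + m * p ^ m ≡⟨ regroup p m (p ^ m) ⟩
  suc p * ((p + m) * p ^ m)             ≤⟨ *-monoʳ-≤ (suc p) ([p+m]*p^m≤p*[1+p]^m p m) ⟩
  suc p * (p * suc p ^ m)               ≡⟨ x∙yz≈y∙xz (suc p) p (suc p ^ m) ⟩
  p * (suc p * suc p ^ m)               ∎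
  where
  open ≤-Reasoning
  regroup : ∀ p m X → (p + suc m) * (p * X) + m * X ≡ suc p * ((p + m) * X)
  regroup = solve-∀

2*p^p≤[1+p]^p : ∀ p → .{{NonZero p}} → 2 * p ^ p ≤ suc p ^ p
2*p^p≤[1+p]^p p = *-cancelˡ-≤ p (begin
  p * (2 * p ^ p) ≡⟨ double p (p ^ p) ⟩
  (p + p) * p ^ p ≤⟨ [p+m]*p^m≤p*[1+p]^m p p ⟩
  p * suc p ^ p   ∎)
  where
  open ≤-Reasoning
  double : ∀ p X → p * (2 * X) ≡ (p + p) * X
  double = solve-∀

2^k*p^[p*k]≤[1+p]^[p*k] : ∀ p → .{{NonZero p}} → ∀ k → 2 ^ k * p ^ (p * k) ≤ suc p ^ (p * k)
2^k*p^[p*k]≤[1+p]^[p*k] p zero rewrite *-zeroʳ p = ≤-refl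
2^k*p^[p*k]≤[1+p]^[p*k] p (suc k)
  rewrite *-suc p k | ^-distribˡ-+-* p p (p * k) | ^-distribˡ-+-* (suc p) p (p * k) = begin
  (2 * 2 ^ k) * (p ^ p * p ^ (p * k)) ≡⟨ interchange 2 (2 ^ k) (p ^ p) (p ^ (p * k)) ⟩
  (2 * p ^ p) * (2 ^ k * p ^ (p * k)) ≤⟨ *-mono-≤ (2*p^p≤[1+p]^p p) (2^k*p^[p*k]≤[1+p]^[p*k] p k) ⟩
  suc p ^ p * suc p ^ (p * k)         ∎
  where open ≤-Reasoning

16*n⁴≤16^n : ∀ n → 16 * (n * n * n * n) ≤ 16 ^ n
16*n⁴≤16^n zero          = z≤n
16*n⁴≤16^n (suc zero)    = ≤-refl
16*n⁴≤16^n (suc (suc n)) = begin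
  16 * (2+n * 2+n * 2+n * 2+n)                 ≤⟨ *-monoʳ-≤ 16 (*-mono-≤ (*-mono-≤ (*-mono-≤ ≤2x ≤2x) ≤2x) ≤2x) ⟩
  16 * (2*[1+n] * 2*[1+n] * 2*[1+n] * 2*[1+n]) ≡⟨ cong (16 *_) (expand (suc n)) ⟩
  16 * (16 * (suc n * suc n * suc n * suc n))  ≤⟨ *-monoʳ-≤ 16 (16*n⁴≤16^n (suc n)) ⟩
  16 * 16 ^ suc n                              ∎
  where
  open ≤-Reasoning
  2+n = suc (suc n)
  2*[1+n] = 2 * suc n
  ≤2x : 2+n ≤ 2*[1+n]
  ≤2x = subst (2+n ≤_) (sym (+-suc (suc n) (n + 0))) (s≤s (s≤s (m≤m+n n (n + 0))))
  expand : ∀ x → (2 * x) * (2 * x) * (2 * x) * (2 * x) ≡ 16 * (x * x * x * x)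
  expand = solve-∀

N*N*p^N≤[1+p]^N : ∀ p → .{{NonZero p}} → p * (4 * p) * (p * (4 * p)) * p ^ (p * (4 * p)) ≤ suc p ^ (p * (4 * p))
N*N*p^N≤[1+p]^N p = begin
  N * N * p ^ N                ≡⟨ cong (_* p ^ N) (N*N≡16*p⁴ p) ⟩
  16 * (p * p * p * p) * p ^ N ≤⟨ *-monoˡ-≤ (p ^ N) (16*n⁴≤16^n p) ⟩
  16 ^ p * p ^ N               ≡⟨ cong (_* p ^ N) (^-*-assoc 2 4 p) ⟩
  2 ^ (4 * p) * p ^ N          ≤⟨ 2^k*p^[p*k]≤[1+p]^[p*k] p (4 * p) ⟩
  suc p ^ N                    ∎
  where
  open ≤-Reasoning
  N = p * (4 * p)
  N*N≡16*p⁴ : ∀ p → p * (4 * p) * (p * (4 * p)) ≡ 16 * (p * p * p * p)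
  N*N≡16*p⁴ = solve-∀

[1+n]²*p≤[1+p]*n² : ∀ n p → suc (p + p) ≤ n → suc n * suc n * p ≤ suc p * (n * n)
[1+n]²*p≤[1+p]*n² n p 2p<n = begin
  suc n * suc n * p             ≡⟨ solve (n ∷ p ∷ []) ⟩
  n * n * p + ((p + p) * n + p) ≤⟨ +-monoʳ-≤ (n * n * p) (+-monoʳ-≤ ((p + p) * n) p≤n) ⟩
  n * n * p + ((p + p) * n + n) ≡⟨ solve (n ∷ p ∷ []) ⟩
  n * n * p + suc (p + p) * n   ≤⟨ +-monoʳ-≤ (n * n * p) (*-monoˡ-≤ n 2p<n) ⟩
  n * n * p + n * n             ≡⟨ solve (n ∷ p ∷ []) ⟩
  suc p * (n * n)               ∎
  where
  open ≤-Reasoning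
  p≤n : p ≤ n
  p≤n = ≤-trans (m≤m+n p p) (≤-trans (n≤1+n (p + p)) 2p<n)

n*n*p^n≤[1+p]^n-step : ∀ n p → suc (p + p) ≤ n → n * n * p ^ n ≤ suc p ^ n →
  suc n * suc n * p ^ suc n ≤ suc p ^ suc n
n*n*p^n≤[1+p]^n-step n p 2p<n ih = begin
  suc n * suc n * (p * p ^ n) ≡⟨ *-assoc (suc n * suc n) p (p ^ n) ⟨
  suc n * suc n * p * p ^ n   ≤⟨ *-monoˡ-≤ (p ^ n) ([1+n]²*p≤[1+p]*n² n p 2p<n) ⟩
  suc p * (n * n) * p ^ n     ≡⟨ *-assoc (suc p) (n * n) (p ^ n) ⟩
  suc p * (n * n * p ^ n)     ≤⟨ *-monoʳ-≤ (suc p) ih ⟩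
  suc p * suc p ^ n           ∎
  where open ≤-Reasoning

n*n*p^n≤[1+p]^n : ∀ p → .{{NonZero p}} → ∀ {n} → p * (4 * p) ≤ n → n * n * p ^ n ≤ suc p ^ n
n*n*p^n≤[1+p]^n p@(suc q) N≤n = from (≤⇒≤′ N≤n)
  where
  2p<N : suc (p + p) ≤ p * (4 * p)
  2p<N = subst (suc (p + p) ≤_) (sym (N≡2p+1+k q)) (m≤m+n (suc (p + p)) _)
    where
    N≡2p+1+k : ∀ q → suc q * (4 * suc q) ≡ suc (suc q + suc q) + (1 + 4 * (q * q) + 6 * q)
    N≡2p+1+k = solve-∀
  from : ∀ {n} → p * (4 * p) ≤′ n → n * n * p ^ n ≤ suc p ^ n
  from ≤′-refl = N*N*p^N≤[1+p]^N p
  from (≤′-step {n} N≤′n) = n*n*p^n≤[1+p]^n-step n p (≤-trans 2p<N (≤′⇒≤ N≤′n)) (from N≤′n)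

n²-absorbed-by-[1+2a]/[2b] : ∀ a b n C {M} → C * b ^ n ≤ n * (n * (a ^ n * M)) →
  n * n * (2 * a) ^ n ≤ suc (2 * a) ^ n → C * (2 * b) ^ n ≤ suc (2 * a) ^ n * M
n²-absorbed-by-[1+2a]/[2b] a b n C {M} count≤ growth = begin
  C * (2 * b) ^ n                 ≡⟨ cong (C *_) (^-distribʳ-* 2 b n) ⟩
  C * (2 ^ n * b ^ n)             ≡⟨ x∙yz≈xz∙y C (2 ^ n) (b ^ n) ⟩
  C * b ^ n * 2 ^ n               ≤⟨ *-monoˡ-≤ (2 ^ n) count≤ ⟩
  n * (n * (a ^ n * M)) * 2 ^ n   ≡⟨ regroup n (a ^ n) M (2 ^ n) ⟩
  n * n * (2 ^ n * a ^ n) * M     ≡⟨ cong (λ x → n * n * x * M) (sym (^-distribʳ-* 2 a n)) ⟩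
  n * n * (2 * a) ^ n * M         ≤⟨ *-monoˡ-≤ M growth ⟩
  suc (2 * a) ^ n * M             ∎
  where
  open ≤-Reasoning
  regroup : ∀ n A M T → n * (n * (A * M)) * T ≡ n * n * (T * A) * M
  regroup = solve-∀

proposition6p3 : (R : (n : ℕ) → Region n) →
    (∀ n → SEJustified (R n)) →
    (∀ n → AvoidsNW (R n)) →
    Σ ℕ (λ a → Σ ℕ (λ b → (1 ≤ a) × (a < b) ×
      (∀ n (i j : Fin n) → R n i j ≡ true →
        countRBPD n (λ g → not (isCross (g i j))) * b ^ n ≤ a ^ n * numRBPD n))) →
    Σ ℕ (λ a′ → Σ ℕ (λ b′ → (1 ≤ a′) × (a′ < b′) ×
      Σ ℕ (λ N → ∀ n → N ≤ n →
        countRBPD n (hitsRegion (R n)) * b′ ^ n ≤ a′ ^ n * numRBPD n)))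
proposition6p3 R seJustified _ (a@(suc _) , b , _ , a<b , cellBound) =
  suc (2 * a) , 2 * b , s≤s z≤n , 1+2a<2b , 2 * a * (4 * (2 * a)) ,
  λ n N≤n → n²-absorbed-by-[1+2a]/[2b] a b n (countRBPD n (hitsRegion (R n)))
    (countRBPD-hitsRegion≤ (R n) (seJustified n) (cellBound n))
    (n*n*p^n≤[1+p]^n (2 * a) N≤n)
  where
  1+2a<2b : suc (2 * a) < 2 * b
  1+2a<2b = subst (_≤ 2 * b) (2*[1+a]≡2+2*a a) (*-monoʳ-≤ 2 a<b)
    where
    2*[1+a]≡2+2*a : ∀ a → 2 * suc a ≡ suc (suc (2 * a))
    2*[1+a]≡2+2*a = solve-∀
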